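{- Let $p$ be a prime, let $s\in\mathbb N$, let $m_1,\ldots,m_s$ be positive integers, and let $k,n_1,\ldots,n_s$ be nonnegative integers with $k\leq n_i$ for all $i$. Write $M=m_1+\cdots+m_s$ and $D=n_1m_1+\cdots+n_sm_s-Mk$. Then $$\int_{\mathbb Z_p}B_{k,n_1}^{m_1}(x)B_{k,n_2}^{m_2}(x)\cdots B_{k,n_s}^{m_s}(x)\,d\mu_1(x)=\binom{n_1}{k}^{m_1}\binom{n_2}{k}^{m_2}\cdots\binom{n_s}{k}^{m_s}\sum_{l=0}^{D}(-1)^{l}\binom{D}{l}B_{Mk+l}.$$
   Context: For integers $0\leq k\leq n$, the Bernstein polynomial is $B_{k,n}(x)=\binom{n}{k}x^k(1-x)^{n-k}$, and $B_{k,n}^{m}(x)$ denotes the $m$-fold product $B_{k,n}(x)\cdots B_{k,n}(x)$. $\mathbb Z_p$ denotes the ring of $p$-adic integers, and for a uniformly differentiable $f:\mathbb Z_p\to\mathbb C_p$ the bosonic $p$-adic (Volkenborn) integral is $\int_{\mathbb Z_p}f(x)\,d\mu_1(x)=\lim_{N\to\infty}\frac{1}{p^N}\sum_{x=0}^{p^N-1}f(x)$. $B_m$ denotes the $m$-th Bernoulli number, defined by $\frac{t}{e^t-1}=\sum_{m\geq0}B_m\frac{t^m}{m!}$; one has $\int_{\mathbb Z_p}x^m\,d\mu_1(x)=B_m$. -}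

module Defs where

open import Data.Nat as ℕ using (ℕ; zero; suc; NonZero)
open import Data.Nat.Combinatorics using (_C_)
open import Data.Nat.Properties using (m^n≢0)
open import Data.Nat.Primality using (Prime; prime⇒nonZero)
open import Data.Nat.Divisibility using (_∣_)
open import Data.Integer as ℤ using (ℤ; +_; -[1+_])
open import Data.Rational as ℚ using (ℚ; ↥_)
open import Data.Fin using (Fin; zero; suc)
open import Data.List using (List; []; _∷_; length)

ΣF : ∀ {s} → (Fin s → ℕ) → ℕ
ΣF {zero}  f = 0
ΣF {suc s} f = f zero ℕ.+ ΣF (λ i → f (suc i))

ΠFℕ : ∀ {s} → (Fin s → ℕ) → ℕ
ΠFℕ {zero}  f = 1
ΠFℕ {suc s} f = f zero ℕ.* ΠFℕ (λ i → f (suc i))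

ΠFℤ : ∀ {s} → (Fin s → ℤ) → ℤ
ΠFℤ {zero}  f = ℤ.+ 1
ΠFℤ {suc s} f = f zero ℤ.* ΠFℤ (λ i → f (suc i))

Σ< : ℕ → (ℕ → ℤ) → ℤ
Σ< zero    f = + 0
Σ< (suc L) f = Σ< L f ℤ.+ f L

Σ<ℚ : ℕ → (ℕ → ℚ) → ℚ
Σ<ℚ zero    f = ℚ.0ℚ
Σ<ℚ (suc L) f = Σ<ℚ L f ℚ.+ f L

-- Bernoulli numbers (convention t/(e^t-1), so B_1 = -1/2), via the
-- recurrence  Σ_{j=0}^{m} C(m+1,j) B_j = 0 (m ≥ 1), B_0 = 1, which is
-- equivalent to the generating-function definition.
-- bernRev m = [B_m, B_{m-1}, ..., B_0]
bernRev : ℕ → List ℚ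
bernRev zero    = ℚ.1ℚ ∷ []
bernRev (suc m) = next ∷ bs
  where
  bs = bernRev m
  -- Σ_{j=0}^{m} C(m+2, j) B_j, with j = length of the tail
  go : List ℚ → ℚ
  go []       = ℚ.0ℚ
  go (b ∷ cs) = ((+ ((suc (suc m)) C (length cs))) ℚ./ 1) ℚ.* b ℚ.+ go cs
  next = ℚ.- (((+ 1) ℚ./ (suc (suc m))) ℚ.* go bs)

bernoulli : ℕ → ℚ
bernoulli m with bernRev m
... | []    = ℚ.0ℚ
... | b ∷ _ = b

bernstein : ℕ → ℕ → ℤ → ℤ
bernstein k n x = (+ (n C k)) ℤ.* (x ℤ.^ k) ℤ.* ((+ 1 ℤ.- x) ℤ.^ (n ℕ.∸ k))

riemann : (p : ℕ) → Prime p → (ℤ → ℤ) → ℕ → ℚ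
riemann p pr f N = Σ< (p ℕ.^ N) (λ x → f (+ x)) ℚ./ (p ℕ.^ N)
  where instance
    _ : NonZero p
    _ = prime⇒nonZero pr
    _ : NonZero (p ℕ.^ N)
    _ = m^n≢0 p N

-- p-adic valuation of a rational is ≥ e (numerator in lowest terms divisible by p^e)
valGE : ℕ → ℕ → ℚ → Set
valGE p e q = (p ℕ.^ e) ∣ ℤ.∣ ↥ q ∣

ConvergesPadic : ℕ → (ℕ → ℚ) → ℚ → Set
ConvergesPadic p a c = ∀ (e : ℕ) → Σ ℕ λ N₀ → ∀ N → N₀ ℕ.≤ N → valGE p e (a N ℚ.- c)
  where open import Data.Product using (Σ)

-- ∫_{Z_p} f dμ₁ = c  (bosonic p-adic / Volkenborn integral, as a p-adic limit)
VolkenbornIntegral≡ : (p : ℕ) → Prime p → (ℤ → ℤ) → ℚ → Set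
VolkenbornIntegral≡ p pr f c = ConvergesPadic p (riemann p pr f) c

bernProd : ∀ {s} → ℕ → (Fin s → ℕ) → (Fin s → ℕ) → ℤ → ℤ
bernProd k n m x = ΠFℤ (λ i → bernstein k (n i) x ℤ.^ m i)

rhs : ∀ {s} → ℕ → (Fin s → ℕ) → (Fin s → ℕ) → ℚ
rhs k n m =
  ((+ ΠFℕ (λ i → (n i C k) ℕ.^ m i)) ℚ./ 1) ℚ.*
  Σ<ℚ (suc D) (λ l → (((-[1+ 0 ] ℤ.^ l) ℤ.* + (D C l)) ℚ./ 1) ℚ.* bernoulli (M ℕ.* k ℕ.+ l))
  where
  M = ΣF m
  D = ΣF (λ i → n i ℕ.* m i) ℕ.∸ M ℕ.* k

-- Put L = p^N and S_j(L) = Σ_{x<L} x^j, so that S_j(L)/L is the Riemann sum of x^j.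
-- Telescoping the binomial expansion of (x+1)^{j+1} − x^{j+1} gives
-- Σ_{i≤j} C(j+1,i) S_i(L) = L^{j+1}, while for j ≥ 1 the Bernoulli numbers satisfy the
-- same recurrence with right-hand side 0.  By strong induction on j, (j+1)! times the
-- defect S_j(L) − L·B_j is therefore an integer multiple of L².  The integrand is
-- Π C(n_i,k)^{m_i} · x^{Mk}(1−x)^D, so expanding (1−x)^D shows that L·(Mk+D+1)! times
-- (Riemann sum − right-hand side) is an integer multiple of L²: p^N divides (Mk+D+1)!
-- times the numerator of the error.  As the p-adic valuation of g is below g, the
-- numerator is divisible by p^e as soon as N ≥ e + (Mk+D+1)!.

module Submission where

open import Defs
open import Data.Nat using (ℕ; _≤_)
open import Data.Nat.Primality using (Prime)
open import Data.Fin using (Fin)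

open import Algebra.Bundles using (CommutativeRing)
import Algebra.Properties.CommutativeSemigroup as CommutativeSemigroupProperties
import Algebra.Properties.Ring as RingProperties
open import Data.Nat as ℕ using (zero; suc; _∸_; _<_; s≤s; z≤n; NonZero; _!)
import Data.Nat.Properties as ℕP
import Data.Nat.Tactic.RingSolver as ℕSolver
open import Data.Nat.Combinatorics using (_C_; nCn≡1; nC1≡n; nCk≡nC[n∸k]; k>n⇒nCk≡0; nCk+nC[k+1]≡[n+1]C[k+1])
open import Data.Nat.Divisibility using (_∣_; _∣?_; divides; 1∣_; ∣-trans; m∣m*n; *-monoʳ-∣; *-cancelˡ-∣; ∣⇒≤; m≤n⇒m!∣n!)
open import Data.Nat.Induction using (<-rec)
open import Data.Nat.Primality using (euclidsLemma; prime⇒nonTrivial; prime⇒nonZero)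
open import Data.Integer as ℤ using (ℤ; +_; -[1+_])
import Data.Integer.Properties as ℤP
open import Data.Integer.GCD using (gcd)
open import Data.Integer.Tactic.RingSolver using (solve-∀)
open import Data.Rational as ℚ using (ℚ; ↥_; ↧_)
import Data.Rational.Properties as ℚP
open import Data.Rational.Solver using (module +-*-Solver)
open +-*-Solver using (solve; _:=_; _:*_; _:+_; _:-_; :-_; con)
open import Data.Rational.Unnormalised as ℚᵘ using (mkℚᵘ; *≡*) renaming (_≃_ to _≃ᵘ_)
import Data.Rational.Unnormalised.Properties as ℚᵘP
open import Data.Fin using (zero; suc)
open import Data.List using (List; length)
open import Data.Product using (Σ; ∃; _,_; proj₁)
open import Data.Sum using (inj₁; inj₂)
open import Relation.Nullary using (¬_; yes; no; contradiction)
open import Relation.Binary.PropositionalEquality as ≡ using (_≡_; refl; cong; cong₂; module ≡-Reasoning)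

module RangeSum {c ℓ} (R : CommutativeRing c ℓ)
  (∑ : ℕ → (ℕ → CommutativeRing.Carrier R) → CommutativeRing.Carrier R)
  (∑-zero : ∀ f → CommutativeRing._≈_ R (∑ 0 f) (CommutativeRing.0# R))
  (∑-suc : ∀ n f → CommutativeRing._≈_ R (∑ (suc n) f) (CommutativeRing._+_ R (∑ n f) (f n))) where

  open CommutativeRing R

  open import Relation.Binary.Reasoning.Setoid setoid
  open CommutativeSemigroupProperties +-commutativeSemigroup using (interchange)
  open RingProperties ring using (-‿+-comm; -0#≈0#)

  ∑-cong : ∀ n {f g} → (∀ i → f i ≈ g i) → ∑ n f ≈ ∑ n g
  ∑-cong zero    {f} {g} _   = trans (∑-zero f) (sym (∑-zero g))
  ∑-cong (suc n) {f} {g} f≈g = begin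
    ∑ (suc n) f  ≈⟨ ∑-suc n f ⟩
    ∑ n f + f n  ≈⟨ +-cong (∑-cong n f≈g) (f≈g n) ⟩
    ∑ n g + g n  ≈⟨ ∑-suc n g ⟨
    ∑ (suc n) g  ∎

  ∑-0# : ∀ n → ∑ n (λ _ → 0#) ≈ 0#
  ∑-0# zero    = ∑-zero _
  ∑-0# (suc n) = begin
    ∑ (suc n) (λ _ → 0#)  ≈⟨ ∑-suc n _ ⟩
    ∑ n (λ _ → 0#) + 0#   ≈⟨ +-congʳ (∑-0# n) ⟩
    0# + 0#               ≈⟨ +-identityˡ 0# ⟩
    0#                    ∎

  ∑-distrib-+ : ∀ n f g → ∑ n (λ i → f i + g i) ≈ ∑ n f + ∑ n g
  ∑-distrib-+ zero    f g = begin
    ∑ 0 _      ≈⟨ ∑-zero _ ⟩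
    0#         ≈⟨ +-identityˡ 0# ⟨
    0# + 0#    ≈⟨ +-cong (∑-zero f) (∑-zero g) ⟨
    ∑ 0 f + ∑ 0 g ∎
  ∑-distrib-+ (suc n) f g = begin
    ∑ (suc n) (λ i → f i + g i)            ≈⟨ ∑-suc n _ ⟩
    ∑ n (λ i → f i + g i) + (f n + g n)    ≈⟨ +-congʳ (∑-distrib-+ n f g) ⟩
    (∑ n f + ∑ n g) + (f n + g n)          ≈⟨ interchange _ _ _ _ ⟩
    (∑ n f + f n) + (∑ n g + g n)          ≈⟨ +-cong (∑-suc n f) (∑-suc n g) ⟨
    ∑ (suc n) f + ∑ (suc n) g              ∎

  *-distribˡ-∑ : ∀ n x f → x * ∑ n f ≈ ∑ n (λ i → x * f i)
  *-distribˡ-∑ zero    x f = begin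
    x * ∑ 0 f  ≈⟨ *-congˡ (∑-zero f) ⟩
    x * 0#     ≈⟨ zeroʳ x ⟩
    0#         ≈⟨ ∑-zero _ ⟨
    ∑ 0 _      ∎
  *-distribˡ-∑ (suc n) x f = begin
    x * ∑ (suc n) f                  ≈⟨ *-congˡ (∑-suc n f) ⟩
    x * (∑ n f + f n)                ≈⟨ distribˡ x _ _ ⟩
    x * ∑ n f + x * f n              ≈⟨ +-congʳ (*-distribˡ-∑ n x f) ⟩
    ∑ n (λ i → x * f i) + x * f n    ≈⟨ ∑-suc n _ ⟨
    ∑ (suc n) (λ i → x * f i)        ∎

  -‿distrib-∑ : ∀ n f → - ∑ n f ≈ ∑ n (λ i → - f i)
  -‿distrib-∑ zero    f = begin
    - ∑ 0 f  ≈⟨ -‿cong (∑-zero f) ⟩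
    - 0#     ≈⟨ -0#≈0# ⟩
    0#       ≈⟨ ∑-zero _ ⟨
    ∑ 0 _    ∎
  -‿distrib-∑ (suc n) f = begin
    - ∑ (suc n) f                ≈⟨ -‿cong (∑-suc n f) ⟩
    - (∑ n f + f n)              ≈⟨ -‿+-comm _ _ ⟨
    - ∑ n f + - f n              ≈⟨ +-congʳ (-‿distrib-∑ n f) ⟩
    ∑ n (λ i → - f i) + - f n    ≈⟨ ∑-suc n _ ⟨
    ∑ (suc n) (λ i → - f i)      ∎

  ∑-head : ∀ n f → ∑ (suc n) f ≈ f 0 + ∑ n (λ i → f (suc i))
  ∑-head zero    f = begin
    ∑ 1 f           ≈⟨ ∑-suc 0 f ⟩
    ∑ 0 f + f 0     ≈⟨ +-congʳ (∑-zero f) ⟩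
    0# + f 0        ≈⟨ +-comm 0# (f 0) ⟩
    f 0 + 0#        ≈⟨ +-congˡ (∑-zero _) ⟨
    f 0 + ∑ 0 _     ∎
  ∑-head (suc n) f = begin
    ∑ (suc (suc n)) f                                ≈⟨ ∑-suc (suc n) f ⟩
    ∑ (suc n) f + f (suc n)                          ≈⟨ +-congʳ (∑-head n f) ⟩
    (f 0 + ∑ n (λ i → f (suc i))) + f (suc n)        ≈⟨ +-assoc _ _ _ ⟩
    f 0 + (∑ n (λ i → f (suc i)) + f (suc n))        ≈⟨ +-congˡ (∑-suc n _) ⟨
    f 0 + ∑ (suc n) (λ i → f (suc i))                ∎

  ∑-comm : ∀ m n (g : ℕ → ℕ → Carrier) → ∑ m (λ i → ∑ n (g i)) ≈ ∑ n (λ j → ∑ m (λ i → g i j))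
  ∑-comm zero    n g = begin
    ∑ 0 _                        ≈⟨ ∑-zero _ ⟩
    0#                           ≈⟨ ∑-0# n ⟨
    ∑ n (λ _ → 0#)               ≈⟨ ∑-cong n (λ j → ∑-zero _) ⟨
    ∑ n (λ j → ∑ 0 (λ i → g i j)) ∎
  ∑-comm (suc m) n g = begin
    ∑ (suc m) (λ i → ∑ n (g i))                                 ≈⟨ ∑-suc m _ ⟩
    ∑ m (λ i → ∑ n (g i)) + ∑ n (g m)                           ≈⟨ +-congʳ (∑-comm m n g) ⟩
    ∑ n (λ j → ∑ m (λ i → g i j)) + ∑ n (g m)                   ≈⟨ ∑-distrib-+ n _ _ ⟨
    ∑ n (λ j → ∑ m (λ i → g i j) + g m j)                       ≈⟨ ∑-cong n (λ j → ∑-suc m _) ⟨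
    ∑ n (λ j → ∑ (suc m) (λ i → g i j))                         ∎

fromℤ : ℤ → ℚ
fromℤ z = z ℚ./ 1

private
  toℚᵘ-fromℤ : ∀ z → ℚ.toℚᵘ (fromℤ z) ≃ᵘ mkℚᵘ z 0
  toℚᵘ-fromℤ z = ℚP.toℚᵘ-fromℚᵘ (mkℚᵘ z 0)

  toℚᵘ-mkℚᵘ : ∀ q → ℚ.toℚᵘ q ≃ᵘ mkℚᵘ (↥ q) (ℚ.denominator-1 q)
  toℚᵘ-mkℚᵘ (ℚ.mkℚ _ _ _) = ℚᵘP.≃-refl

  scaled-+ : ∀ a b → (a ℤ.+ b) ℤ.* + 1 ≡ (a ℤ.* + 1 ℤ.+ b ℤ.* + 1) ℤ.* + 1
  scaled-+ = solve-∀

fromℤ-homo-+ : ∀ a b → fromℤ (a ℤ.+ b) ≡ fromℤ a ℚ.+ fromℤ b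
fromℤ-homo-+ a b = ℚP.toℚᵘ-injective (begin
  ℚ.toℚᵘ (fromℤ (a ℤ.+ b))               ≈⟨ toℚᵘ-fromℤ (a ℤ.+ b) ⟩
  mkℚᵘ (a ℤ.+ b) 0                       ≈⟨ *≡* (scaled-+ a b) ⟩
  mkℚᵘ a 0 ℚᵘ.+ mkℚᵘ b 0                 ≈⟨ ℚᵘP.+-cong (toℚᵘ-fromℤ a) (toℚᵘ-fromℤ b) ⟨
  ℚ.toℚᵘ (fromℤ a) ℚᵘ.+ ℚ.toℚᵘ (fromℤ b) ≈⟨ ℚP.toℚᵘ-homo-+ (fromℤ a) (fromℤ b) ⟨
  ℚ.toℚᵘ (fromℤ a ℚ.+ fromℤ b)           ∎)
  where open ℚᵘP.≃-Reasoning

fromℤ-homo-* : ∀ a b → fromℤ (a ℤ.* b) ≡ fromℤ a ℚ.* fromℤ b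
fromℤ-homo-* a b = ℚP.toℚᵘ-injective (begin
  ℚ.toℚᵘ (fromℤ (a ℤ.* b))               ≈⟨ toℚᵘ-fromℤ (a ℤ.* b) ⟩
  mkℚᵘ a 0 ℚᵘ.* mkℚᵘ b 0                 ≈⟨ ℚᵘP.*-cong (toℚᵘ-fromℤ a) (toℚᵘ-fromℤ b) ⟨
  ℚ.toℚᵘ (fromℤ a) ℚᵘ.* ℚ.toℚᵘ (fromℤ b) ≈⟨ ℚP.toℚᵘ-homo-* (fromℤ a) (fromℤ b) ⟨
  ℚ.toℚᵘ (fromℤ a ℚ.* fromℤ b)           ∎)
  where open ℚᵘP.≃-Reasoning

fromℤ-+-* : ∀ m n → fromℤ (+ (m ℕ.* n)) ≡ fromℤ (+ m) ℚ.* fromℤ (+ n)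
fromℤ-+-* m n = ≡.trans (cong fromℤ (ℤP.pos-* m n)) (fromℤ-homo-* (+ m) (+ n))

fromℤ-homo‿- : ∀ a → fromℤ (ℤ.- a) ≡ ℚ.- fromℤ a
fromℤ-homo‿- a = ℚP.toℚᵘ-injective (begin
  ℚ.toℚᵘ (fromℤ (ℤ.- a))   ≈⟨ toℚᵘ-fromℤ (ℤ.- a) ⟩
  ℚᵘ.- mkℚᵘ a 0            ≈⟨ ℚᵘP.-‿cong (toℚᵘ-fromℤ a) ⟨
  ℚᵘ.- ℚ.toℚᵘ (fromℤ a)    ≈⟨ ℚP.toℚᵘ-homo‿- (fromℤ a) ⟨
  ℚ.toℚᵘ (ℚ.- fromℤ a)     ∎)
  where open ℚᵘP.≃-Reasoning

L*↥[z/L]≡z*↧[z/L] : ∀ z L .{{_ : NonZero L}} → + L ℤ.* ↥ (z ℚ./ L) ≡ z ℤ.* ↧ (z ℚ./ L)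
L*↥[z/L]≡z*↧[z/L] z L = begin
  + L ℤ.* ↥ q            ≡⟨ cong (ℤ._* ↥ q) (ℚP.↧-/ z L) ⟨
  (↧ q ℤ.* g) ℤ.* ↥ q    ≡⟨ swap (↧ q) g (↥ q) ⟩
  (↥ q ℤ.* g) ℤ.* ↧ q    ≡⟨ cong (ℤ._* ↧ q) (ℚP.↥-/ z L) ⟩
  z ℤ.* ↧ q              ∎
  where
  open ≡-Reasoning
  q = z ℚ./ L
  g = gcd z (+ L)
  swap : ∀ a b c → (a ℤ.* b) ℤ.* c ≡ (c ℤ.* b) ℤ.* a
  swap = solve-∀

fromℤ-*-/ : ∀ z L .{{_ : NonZero L}} → fromℤ (+ L) ℚ.* (z ℚ./ L) ≡ fromℤ z
fromℤ-*-/ z L = ℚP.toℚᵘ-injective (begin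
  ℚ.toℚᵘ (fromℤ (+ L) ℚ.* q)                       ≈⟨ ℚP.toℚᵘ-homo-* (fromℤ (+ L)) q ⟩
  ℚ.toℚᵘ (fromℤ (+ L)) ℚᵘ.* ℚ.toℚᵘ q               ≈⟨ ℚᵘP.*-cong (toℚᵘ-fromℤ (+ L)) (toℚᵘ-mkℚᵘ q) ⟩
  mkℚᵘ (+ L) 0 ℚᵘ.* mkℚᵘ (↥ q) (ℚ.denominator-1 q) ≈⟨ *≡* cross ⟩
  mkℚᵘ z 0                                         ≈⟨ toℚᵘ-fromℤ z ⟨
  ℚ.toℚᵘ (fromℤ z)                                 ∎)
  where
  open ℚᵘP.≃-Reasoning
  q = z ℚ./ L
  cross : (+ L ℤ.* ↥ q) ℤ.* + 1 ≡ z ℤ.* + suc (ℚ.denominator-1 q ℕ.+ 0)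
  cross = ≡.trans (ℤP.*-identityʳ _) (≡.trans (L*↥[z/L]≡z*↧[z/L] z L)
            (cong (λ d → z ℤ.* + suc d) (≡.sym (ℕP.+-identityʳ _))))

q*b≡c⇒↥q*b≡c*↧q : ∀ q b c → q ℚ.* fromℤ b ≡ fromℤ c → ↥ q ℤ.* b ≡ c ℤ.* ↧ q
q*b≡c⇒↥q*b≡c*↧q q b c eq with ℚᵘP.≃-trans eqᵘ (toℚᵘ-fromℤ c)
  where
  eqᵘ : mkℚᵘ (↥ q) (ℚ.denominator-1 q) ℚᵘ.* mkℚᵘ b 0 ≃ᵘ ℚ.toℚᵘ (fromℤ c)
  eqᵘ = begin
    mkℚᵘ (↥ q) (ℚ.denominator-1 q) ℚᵘ.* mkℚᵘ b 0 ≈⟨ ℚᵘP.*-cong (toℚᵘ-mkℚᵘ q) (toℚᵘ-fromℤ b) ⟨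
    ℚ.toℚᵘ q ℚᵘ.* ℚ.toℚᵘ (fromℤ b)              ≈⟨ ℚP.toℚᵘ-homo-* q (fromℤ b) ⟨
    ℚ.toℚᵘ (q ℚ.* fromℤ b)                      ≡⟨ cong ℚ.toℚᵘ eq ⟩
    ℚ.toℚᵘ (fromℤ c)                            ∎
    where open ℚᵘP.≃-Reasoning
... | *≡* cross = ≡.trans (≡.sym (ℤP.*-identityʳ _))
  (≡.trans cross (cong (λ d → c ℤ.* + suc d) (ℕP.*-identityʳ _)))

module ℤ∑ = RangeSum ℤP.+-*-commutativeRing Σ< (λ _ → refl) (λ _ _ → refl)
module ℚ∑ = RangeSum ℚP.+-*-commutativeRing Σ<ℚ (λ _ → refl) (λ _ _ → refl)

fromℤ-Σ< : ∀ n f → fromℤ (Σ< n f) ≡ Σ<ℚ n (λ i → fromℤ (f i))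
fromℤ-Σ< zero    f = refl
fromℤ-Σ< (suc n) f = ≡.trans (fromℤ-homo-+ (Σ< n f) (f n)) (cong (ℚ._+ fromℤ (f n)) (fromℤ-Σ< n f))

binomialTerm : ℕ → ℤ → ℕ → ℤ
binomialTerm n y i = + (n C i) ℤ.* y ℤ.^ i

binomial : ∀ n y → (+ 1 ℤ.+ y) ℤ.^ n ≡ Σ< (suc n) (binomialTerm n y)
binomial zero    y = refl
binomial (suc n) y = begin
  (+ 1 ℤ.+ y) ℤ.* (+ 1 ℤ.+ y) ℤ.^ n                         ≡⟨ cong ((+ 1 ℤ.+ y) ℤ.*_) (binomial n y) ⟩
  (+ 1 ℤ.+ y) ℤ.* ∑T                                        ≡⟨ expand y ∑T ⟩
  ∑T ℤ.+ y ℤ.* ∑T                                           ≡⟨ cong₂ ℤ._+_ ∑T≡1+∑next y∑T≡∑shift ⟩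
  (+ 1 ℤ.+ Σ< (suc n) next) ℤ.+ Σ< (suc n) shifted           ≡⟨ regroup (Σ< (suc n) shifted) (Σ< (suc n) next) ⟩
  + 1 ℤ.+ (Σ< (suc n) shifted ℤ.+ Σ< (suc n) next)          ≡⟨ cong (λ t → + 1 ℤ.+ t) (ℤ∑.∑-distrib-+ (suc n) shifted next) ⟨
  + 1 ℤ.+ Σ< (suc n) (λ i → shifted i ℤ.+ next i)            ≡⟨ cong (λ t → + 1 ℤ.+ t) (ℤ∑.∑-cong (suc n) pascal) ⟩
  + 1 ℤ.+ Σ< (suc n) (λ i → binomialTerm (suc n) y (suc i))  ≡⟨ ℤ∑.∑-head (suc n) (binomialTerm (suc n) y) ⟨
  Σ< (suc (suc n)) (binomialTerm (suc n) y)                  ∎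
  where
  open ≡-Reasoning
  ∑T = Σ< (suc n) (binomialTerm n y)
  shifted next : ℕ → ℤ
  shifted i = + (n C i) ℤ.* y ℤ.^ suc i
  next i = + (n C suc i) ℤ.* y ℤ.^ suc i
  expand : ∀ y s → (+ 1 ℤ.+ y) ℤ.* s ≡ s ℤ.+ y ℤ.* s
  expand = solve-∀
  regroup : ∀ a b → (+ 1 ℤ.+ b) ℤ.+ a ≡ + 1 ℤ.+ (a ℤ.+ b)
  regroup = solve-∀
  commute : ∀ y c t → y ℤ.* (c ℤ.* t) ≡ c ℤ.* (y ℤ.* t)
  commute = solve-∀
  y∑T≡∑shift : y ℤ.* ∑T ≡ Σ< (suc n) shifted
  y∑T≡∑shift = ≡.trans (ℤ∑.*-distribˡ-∑ (suc n) y (binomialTerm n y))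
    (ℤ∑.∑-cong (suc n) (λ i → commute y (+ (n C i)) (y ℤ.^ i)))
  ∑T≡1+∑next : ∑T ≡ + 1 ℤ.+ Σ< (suc n) next
  ∑T≡1+∑next = begin
    ∑T                                ≡⟨ ℤP.+-identityʳ ∑T ⟨
    ∑T ℤ.+ + 0 ℤ.* y ℤ.^ suc n         ≡⟨ cong (λ c → ∑T ℤ.+ + c ℤ.* y ℤ.^ suc n) (k>n⇒nCk≡0 (ℕP.n<1+n n)) ⟨
    Σ< (suc (suc n)) (binomialTerm n y) ≡⟨ ℤ∑.∑-head (suc n) (binomialTerm n y) ⟩
    + 1 ℤ.+ Σ< (suc n) next            ∎
  pascal : ∀ i → shifted i ℤ.+ next i ≡ binomialTerm (suc n) y (suc i)
  pascal i = ≡.trans (≡.sym (ℤP.*-distribʳ-+ (y ℤ.^ suc i) (+ (n C i)) (+ (n C suc i))))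
    (cong (λ c → + c ℤ.* y ℤ.^ suc i) (nCk+nC[k+1]≡[n+1]C[k+1] n i))

powerSum : ℕ → ℕ → ℤ
powerSum j L = Σ< L (λ x → (+ x) ℤ.^ j)

powerSum-zero : ∀ L → powerSum 0 L ≡ + L
powerSum-zero zero    = refl
powerSum-zero (suc L) = ≡.trans (cong (ℤ._+ + 1) (powerSum-zero L)) (cong +_ (ℕP.+-comm L 1))

powerSum-recurrence : ∀ j L → Σ< (suc j) (λ i → + (suc j C i) ℤ.* powerSum i L) ≡ (+ L) ℤ.^ suc j
powerSum-recurrence j zero = begin
  Σ< (suc j) (λ i → + (suc j C i) ℤ.* + 0)  ≡⟨ ℤ∑.∑-cong (suc j) (λ i → ℤP.*-zeroʳ (+ (suc j C i))) ⟩
  Σ< (suc j) (λ _ → + 0)                    ≡⟨ ℤ∑.∑-0# (suc j) ⟩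
  + 0                                       ≡⟨ ℤP.*-zeroˡ ((+ 0) ℤ.^ j) ⟨
  (+ 0) ℤ.^ suc j                             ∎
  where open ≡-Reasoning
powerSum-recurrence j (suc L) = begin
  Σ< (suc j) (λ i → + (suc j C i) ℤ.* (powerSum i L ℤ.+ (+ L) ℤ.^ i))
    ≡⟨ ℤ∑.∑-cong (suc j) (λ i → ℤP.*-distribˡ-+ (+ (suc j C i)) (powerSum i L) ((+ L) ℤ.^ i)) ⟩
  Σ< (suc j) (λ i → + (suc j C i) ℤ.* powerSum i L ℤ.+ binomialTerm (suc j) (+ L) i)
    ≡⟨ ℤ∑.∑-distrib-+ (suc j) _ _ ⟩
  Σ< (suc j) (λ i → + (suc j C i) ℤ.* powerSum i L) ℤ.+ lower
    ≡⟨ cong (ℤ._+ lower) (powerSum-recurrence j L) ⟩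
  (+ L) ℤ.^ suc j ℤ.+ lower
    ≡⟨ ℤP.+-comm ((+ L) ℤ.^ suc j) lower ⟩
  lower ℤ.+ (+ L) ℤ.^ suc j
    ≡⟨ cong (λ c → lower ℤ.+ c) (ℤP.*-identityˡ ((+ L) ℤ.^ suc j)) ⟨
  lower ℤ.+ + 1 ℤ.* (+ L) ℤ.^ suc j
    ≡⟨ cong (λ c → lower ℤ.+ + c ℤ.* (+ L) ℤ.^ suc j) (nCn≡1 (suc j)) ⟨
  Σ< (suc (suc j)) (binomialTerm (suc j) (+ L))
    ≡⟨ binomial (suc j) (+ L) ⟨
  (+ suc L) ℤ.^ suc j ∎
  where
  open ≡-Reasoning
  lower = Σ< (suc j) (binomialTerm (suc j) (+ L))

[n+1]Cn≡n+1 : ∀ n → suc n C n ≡ suc n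
[n+1]Cn≡n+1 n = ≡.trans (nCk≡nC[n∸k] (ℕP.n≤1+n n))
  (≡.trans (cong (suc n C_) (ℕP.m+n∸n≡m 1 n)) (nC1≡n (suc n)))

private
  -- `bernRev (suc m)` sums over `bernRev m` with a function local to its where block.
  -- It cannot be named here, but once `bernRev m` is abstracted to a variable,
  -- unification recovers it from the normal form of `bernoulli (suc m)`.
  implicitOf : {h : List ℚ → ℚ} → ((xs : List ℚ) → h xs ≡ h xs) → List ℚ → ℚ
  implicitOf {h} _ = h

  bernoulli-suc : ∀ m → Σ (List ℚ → ℚ) λ go →
    bernoulli (suc m) ≡ ℚ.- ((+ 1 ℚ./ suc (suc m)) ℚ.* go (bernRev m))
  bernoulli-suc m with bernRev m | (λ (xs : List ℚ) → refl {A = ℚ} {x = _})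
  ... | _ | r = implicitOf r , refl

  go : ℕ → List ℚ → ℚ
  go m = proj₁ (bernoulli-suc m)

  length-bernRev : ∀ t → length (bernRev t) ≡ suc t
  length-bernRev zero    = refl
  length-bernRev (suc t) = cong suc (length-bernRev t)

  binomialBernoulli : ℕ → ℕ → ℚ
  binomialBernoulli n i = fromℤ (+ (n C i)) ℚ.* bernoulli i

  go-bernRev : ∀ m t → go m (bernRev t) ≡ Σ<ℚ (suc t) (binomialBernoulli (suc (suc m)))
  go-bernRev m zero    = ℚP.+-comm (binomialBernoulli (suc (suc m)) 0) ℚ.0ℚ
  go-bernRev m (suc t) = begin
    fromℤ (+ (suc (suc m) C length (bernRev t))) ℚ.* bernoulli (suc t) ℚ.+ go m (bernRev t)
      ≡⟨ cong₂ (λ l s → fromℤ (+ (suc (suc m) C l)) ℚ.* bernoulli (suc t) ℚ.+ s) (length-bernRev t) (go-bernRev m t) ⟩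
    binomialBernoulli (suc (suc m)) (suc t) ℚ.+ Σ<ℚ (suc t) (binomialBernoulli (suc (suc m)))
      ≡⟨ ℚP.+-comm (binomialBernoulli (suc (suc m)) (suc t)) _ ⟩
    Σ<ℚ (suc (suc t)) (binomialBernoulli (suc (suc m))) ∎
    where open ≡-Reasoning

bernoulli-recurrence : ∀ m → Σ<ℚ (suc (suc m)) (λ i → fromℤ (+ (suc (suc m) C i)) ℚ.* bernoulli i) ≡ ℚ.0ℚ
bernoulli-recurrence m = begin
  G′ ℚ.+ fromℤ (+ (suc (suc m) C suc m)) ℚ.* bernoulli (suc m)
    ≡⟨ cong₂ (λ s c → s ℚ.+ fromℤ (+ c) ℚ.* bernoulli (suc m)) (≡.sym (go-bernRev m m)) ([n+1]Cn≡n+1 (suc m)) ⟩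
  G ℚ.+ fromℤ (+ suc (suc m)) ℚ.* (ℚ.- (u ℚ.* G))
    ≡⟨ cong (G ℚ.+_) (ℚP.neg-distribʳ-* (fromℤ (+ suc (suc m))) (u ℚ.* G)) ⟨
  G ℚ.- fromℤ (+ suc (suc m)) ℚ.* (u ℚ.* G)
    ≡⟨ cong (λ x → G ℚ.- x) (ℚP.*-assoc (fromℤ (+ suc (suc m))) u G) ⟨
  G ℚ.- (fromℤ (+ suc (suc m)) ℚ.* u) ℚ.* G
    ≡⟨ cong (λ x → G ℚ.- x ℚ.* G) (fromℤ-*-/ (+ 1) (suc (suc m))) ⟩
  G ℚ.- ℚ.1ℚ ℚ.* G
    ≡⟨ cong (λ x → G ℚ.- x) (ℚP.*-identityˡ G) ⟩
  G ℚ.- G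
    ≡⟨ ℚP.+-inverseʳ G ⟩
  ℚ.0ℚ ∎
  where
  open ≡-Reasoning
  G = go m (bernRev m)
  G′ = Σ<ℚ (suc m) (binomialBernoulli (suc (suc m)))
  u = + 1 ℚ./ suc (suc m)

infix 4 _∈ℤ·_
_∈ℤ·_ : ℚ → ℤ → Set
q ∈ℤ· c = ∃ λ z → q ≡ fromℤ (z ℤ.* c)

module _ {c : ℤ} where

  0∈ℤ· : ℚ.0ℚ ∈ℤ· c
  0∈ℤ· = + 0 , cong fromℤ (≡.sym (ℤP.*-zeroˡ c))

  +-∈ℤ· : ∀ {x y} → x ∈ℤ· c → y ∈ℤ· c → x ℚ.+ y ∈ℤ· c
  +-∈ℤ· (z , refl) (w , refl) = z ℤ.+ w , (begin
    fromℤ (z ℤ.* c) ℚ.+ fromℤ (w ℤ.* c)   ≡⟨ fromℤ-homo-+ (z ℤ.* c) (w ℤ.* c) ⟨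
    fromℤ (z ℤ.* c ℤ.+ w ℤ.* c)           ≡⟨ cong fromℤ (ℤP.*-distribʳ-+ c z w) ⟨
    fromℤ ((z ℤ.+ w) ℤ.* c)               ∎)
    where open ≡-Reasoning

  *-∈ℤ· : ∀ a {x} → x ∈ℤ· c → fromℤ a ℚ.* x ∈ℤ· c
  *-∈ℤ· a (z , refl) = a ℤ.* z , (begin
    fromℤ a ℚ.* fromℤ (z ℤ.* c)   ≡⟨ fromℤ-homo-* a (z ℤ.* c) ⟨
    fromℤ (a ℤ.* (z ℤ.* c))       ≡⟨ cong fromℤ (ℤP.*-assoc a z c) ⟨
    fromℤ (a ℤ.* z ℤ.* c)         ∎)
    where open ≡-Reasoning

  ∈ℤ·-cancelˡ : ∀ {x y} → x ∈ℤ· c → x ℚ.+ y ∈ℤ· c → y ∈ℤ· c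
  ∈ℤ·-cancelˡ {y = y} (z , refl) (w , x+y≡) = w ℤ.- z , (begin
    y                                             ≡⟨ y≡[x+y]-x (fromℤ (z ℤ.* c)) y ⟩
    (fromℤ (z ℤ.* c) ℚ.+ y) ℚ.- fromℤ (z ℤ.* c)     ≡⟨ cong (ℚ._- fromℤ (z ℤ.* c)) x+y≡ ⟩
    fromℤ (w ℤ.* c) ℚ.- fromℤ (z ℤ.* c)            ≡⟨ cong (fromℤ (w ℤ.* c) ℚ.+_) (fromℤ-homo‿- (z ℤ.* c)) ⟨
    fromℤ (w ℤ.* c) ℚ.+ fromℤ (ℤ.- (z ℤ.* c))      ≡⟨ fromℤ-homo-+ (w ℤ.* c) (ℤ.- (z ℤ.* c)) ⟨
    fromℤ (w ℤ.* c ℤ.- z ℤ.* c)                   ≡⟨ cong fromℤ (factor w z c) ⟩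
    fromℤ ((w ℤ.- z) ℤ.* c)                       ∎)
    where
    open ≡-Reasoning
    y≡[x+y]-x : ∀ x y → y ≡ (x ℚ.+ y) ℚ.- x
    y≡[x+y]-x = solve 2 (λ x y → y := (x :+ y) :- x) refl
    factor : ∀ w z c → w ℤ.* c ℤ.- z ℤ.* c ≡ (w ℤ.- z) ℤ.* c
    factor = solve-∀

  Σ<ℚ-∈ℤ· : ∀ n f → (∀ i → i < n → f i ∈ℤ· c) → Σ<ℚ n f ∈ℤ· c
  Σ<ℚ-∈ℤ· zero    f _  = 0∈ℤ·
  Σ<ℚ-∈ℤ· (suc n) f f∈ = +-∈ℤ· (Σ<ℚ-∈ℤ· n f (λ i i<n → f∈ i (ℕP.m<n⇒m<1+n i<n))) (f∈ n ℕP.≤-refl)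

  *-Σ<ℚ-∈ℤ· : ∀ n (a : ℕ → ℤ) (x : ℕ → ℚ) (w : ℕ → ℕ) d →
              (∀ i → i < n → fromℤ (+ w i) ℚ.* x i ∈ℤ· c) → (∀ i → i < n → w i ∣ d) →
              fromℤ (+ d) ℚ.* Σ<ℚ n (λ i → fromℤ (a i) ℚ.* x i) ∈ℤ· c
  *-Σ<ℚ-∈ℤ· n a x w d wx∈ w∣d =
    ≡.subst (_∈ℤ· c) (≡.sym (ℚ∑.*-distribˡ-∑ n (fromℤ (+ d)) _)) (Σ<ℚ-∈ℤ· n _ term∈)
    where
    term∈ : ∀ i → i < n → fromℤ (+ d) ℚ.* (fromℤ (a i) ℚ.* x i) ∈ℤ· c
    term∈ i i<n with w∣d i i<n
    ... | divides t refl = ≡.subst (_∈ℤ· c) (≡.sym regroup) (*-∈ℤ· (a i ℤ.* + t) (wx∈ i i<n))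
      where
      regroup : fromℤ (+ (t ℕ.* w i)) ℚ.* (fromℤ (a i) ℚ.* x i) ≡ fromℤ (a i ℤ.* + t) ℚ.* (fromℤ (+ w i) ℚ.* x i)
      regroup = begin
        fromℤ (+ (t ℕ.* w i)) ℚ.* (fromℤ (a i) ℚ.* x i)
          ≡⟨ cong (ℚ._* (fromℤ (a i) ℚ.* x i)) (fromℤ-+-* t (w i)) ⟩
        fromℤ (+ t) ℚ.* fromℤ (+ w i) ℚ.* (fromℤ (a i) ℚ.* x i)
          ≡⟨ rearrange (fromℤ (+ t)) (fromℤ (+ w i)) (fromℤ (a i)) (x i) ⟩
        fromℤ (a i) ℚ.* fromℤ (+ t) ℚ.* (fromℤ (+ w i) ℚ.* x i)
          ≡⟨ cong (ℚ._* (fromℤ (+ w i) ℚ.* x i)) (fromℤ-homo-* (a i) (+ t)) ⟨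
        fromℤ (a i ℤ.* + t) ℚ.* (fromℤ (+ w i) ℚ.* x i) ∎
        where
        open ≡-Reasoning
        rearrange : ∀ t w a x → t ℚ.* w ℚ.* (a ℚ.* x) ≡ a ℚ.* t ℚ.* (w ℚ.* x)
        rearrange = solve 4 (λ t w a x → t :* w :* (a :* x) := a :* t :* (w :* x)) refl

module _ (L : ℕ) where

  defect : ℕ → ℚ
  defect j = fromℤ (powerSum j L) ℚ.- fromℤ (+ L) ℚ.* bernoulli j

  Σ<ℚ-*-defect : ∀ n (a : ℕ → ℤ) (index : ℕ → ℕ) →
    Σ<ℚ n (λ i → fromℤ (a i) ℚ.* defect (index i)) ≡
    fromℤ (Σ< n (λ i → a i ℤ.* powerSum (index i) L)) ℚ.- fromℤ (+ L) ℚ.* Σ<ℚ n (λ i → fromℤ (a i) ℚ.* bernoulli (index i))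
  Σ<ℚ-*-defect n a index = begin
    Σ<ℚ n (λ i → A i ℚ.* (S i ℚ.- l ℚ.* B i))
      ≡⟨ ℚ∑.∑-cong n (λ i → expand (A i) (S i) l (B i)) ⟩
    Σ<ℚ n (λ i → A i ℚ.* S i ℚ.+ ℚ.- (l ℚ.* (A i ℚ.* B i)))
      ≡⟨ ℚ∑.∑-distrib-+ n _ _ ⟩
    Σ<ℚ n (λ i → A i ℚ.* S i) ℚ.+ Σ<ℚ n (λ i → ℚ.- (l ℚ.* (A i ℚ.* B i)))
      ≡⟨ cong₂ ℚ._+_ (≡.sym fromℤ-Σ<AS) (≡.sym (ℚ∑.-‿distrib-∑ n _)) ⟩
    fromℤ (Σ< n (λ i → a i ℤ.* powerSum (index i) L)) ℚ.- Σ<ℚ n (λ i → l ℚ.* (A i ℚ.* B i))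
      ≡⟨ cong (λ t → fromℤ (Σ< n (λ i → a i ℤ.* powerSum (index i) L)) ℚ.- t) (ℚ∑.*-distribˡ-∑ n l _) ⟨
    fromℤ (Σ< n (λ i → a i ℤ.* powerSum (index i) L)) ℚ.- l ℚ.* Σ<ℚ n (λ i → A i ℚ.* B i) ∎
    where
    open ≡-Reasoning
    l = fromℤ (+ L)
    A = λ i → fromℤ (a i)
    S = λ i → fromℤ (powerSum (index i) L)
    B = λ i → bernoulli (index i)
    expand : ∀ a s l b → a ℚ.* (s ℚ.- l ℚ.* b) ≡ a ℚ.* s ℚ.+ ℚ.- (l ℚ.* (a ℚ.* b))
    expand = solve 4 (λ a s l b → a :* (s :- l :* b) := a :* s :+ :- (l :* (a :* b))) refl
    fromℤ-Σ<AS : fromℤ (Σ< n (λ i → a i ℤ.* powerSum (index i) L)) ≡ Σ<ℚ n (λ i → A i ℚ.* S i)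
    fromℤ-Σ<AS = ≡.trans (fromℤ-Σ< n _) (ℚ∑.∑-cong n (λ i → fromℤ-homo-* (a i) (powerSum (index i) L)))

  defect-recurrence : ∀ j → Σ<ℚ (suc (suc j)) (λ i → fromℤ (+ (suc (suc j) C i)) ℚ.* defect i) ≡
                            fromℤ ((+ L) ℤ.^ suc (suc j))
  defect-recurrence j = begin
    Σ<ℚ (suc (suc j)) (λ i → fromℤ (+ (suc (suc j) C i)) ℚ.* defect i)
      ≡⟨ Σ<ℚ-*-defect (suc (suc j)) (λ i → + (suc (suc j) C i)) (λ i → i) ⟩
    fromℤ (Σ< (suc (suc j)) (λ i → + (suc (suc j) C i) ℤ.* powerSum i L)) ℚ.- fromℤ (+ L) ℚ.* Σ<ℚ (suc (suc j)) _
      ≡⟨ cong₂ (λ s b → fromℤ s ℚ.- fromℤ (+ L) ℚ.* b) (powerSum-recurrence (suc j) L) (bernoulli-recurrence j) ⟩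
    fromℤ ((+ L) ℤ.^ suc (suc j)) ℚ.- fromℤ (+ L) ℚ.* ℚ.0ℚ
      ≡⟨ x-l*0≡x (fromℤ ((+ L) ℤ.^ suc (suc j))) (fromℤ (+ L)) ⟩
    fromℤ ((+ L) ℤ.^ suc (suc j)) ∎
    where
    open ≡-Reasoning
    x-l*0≡x : ∀ x l → x ℚ.- l ℚ.* ℚ.0ℚ ≡ x
    x-l*0≡x = solve 2 (λ x l → x :- l :* con ℚ.0ℚ := x) refl

  factorial-defect-∈ℤ· : ∀ j → fromℤ (+ (suc j !)) ℚ.* defect j ∈ℤ· (+ L ℤ.* + L)
  factorial-defect-∈ℤ· = <-rec _ step
    where
    step : ∀ j → (∀ {i} → i < j → fromℤ (+ (suc i !)) ℚ.* defect i ∈ℤ· (+ L ℤ.* + L)) →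
           fromℤ (+ (suc j !)) ℚ.* defect j ∈ℤ· (+ L ℤ.* + L)
    step zero    _  = ≡.subst (_∈ℤ· (+ L ℤ.* + L)) (≡.sym defect0≡0) 0∈ℤ·
      where
      defect0≡0 : fromℤ (+ 1) ℚ.* defect 0 ≡ ℚ.0ℚ
      defect0≡0 = ≡.trans (cong (λ s → fromℤ (+ 1) ℚ.* (fromℤ s ℚ.- fromℤ (+ L) ℚ.* ℚ.1ℚ)) (powerSum-zero L))
                          (c*[l-l*1]≡0 (fromℤ (+ 1)) (fromℤ (+ L)))
        where
        c*[l-l*1]≡0 : ∀ c l → c ℚ.* (l ℚ.- l ℚ.* ℚ.1ℚ) ≡ ℚ.0ℚ
        c*[l-l*1]≡0 = solve 2 (λ c l → c :* (l :- l :* con ℚ.1ℚ) := con ℚ.0ℚ) refl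
    step (suc j) IH = ∈ℤ·-cancelˡ lower∈ (≡.subst (_∈ℤ· (+ L ℤ.* + L)) total≡ total∈)
      where
      N = suc j
      d = N !
      term = λ i → fromℤ (+ (suc N C i)) ℚ.* defect i
      lower∈ : fromℤ (+ d) ℚ.* Σ<ℚ N term ∈ℤ· (+ L ℤ.* + L)
      lower∈ = *-Σ<ℚ-∈ℤ· N (λ i → + (suc N C i)) defect (λ i → suc i !) d (λ i i<N → IH i<N) (λ i i<N → m≤n⇒m!∣n! i<N)
      total∈ : fromℤ (+ d) ℚ.* fromℤ ((+ L) ℤ.^ suc N) ∈ℤ· (+ L ℤ.* + L)
      total∈ = *-∈ℤ· (+ d) ((+ L) ℤ.^ j , cong fromℤ (x*[x*y]≡y*[x*x] (+ L) ((+ L) ℤ.^ j)))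
        where
        x*[x*y]≡y*[x*x] : ∀ x y → x ℤ.* (x ℤ.* y) ≡ y ℤ.* (x ℤ.* x)
        x*[x*y]≡y*[x*x] = solve-∀
      total≡ : fromℤ (+ d) ℚ.* fromℤ ((+ L) ℤ.^ suc N) ≡
               fromℤ (+ d) ℚ.* Σ<ℚ N term ℚ.+ fromℤ (+ (suc N !)) ℚ.* defect N
      total≡ = begin
        fromℤ (+ d) ℚ.* fromℤ ((+ L) ℤ.^ suc N)
          ≡⟨ cong (fromℤ (+ d) ℚ.*_) (defect-recurrence j) ⟨
        fromℤ (+ d) ℚ.* (Σ<ℚ N term ℚ.+ term N)
          ≡⟨ ℚP.*-distribˡ-+ (fromℤ (+ d)) (Σ<ℚ N term) (term N) ⟩
        fromℤ (+ d) ℚ.* Σ<ℚ N term ℚ.+ fromℤ (+ d) ℚ.* term N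
          ≡⟨ cong (λ t → fromℤ (+ d) ℚ.* Σ<ℚ N term ℚ.+ t) lastTerm ⟩
        fromℤ (+ d) ℚ.* Σ<ℚ N term ℚ.+ fromℤ (+ (suc N !)) ℚ.* defect N ∎
        where
        open ≡-Reasoning
        lastTerm : fromℤ (+ d) ℚ.* term N ≡ fromℤ (+ (suc N !)) ℚ.* defect N
        lastTerm = begin
          fromℤ (+ d) ℚ.* (fromℤ (+ (suc N C N)) ℚ.* defect N)
            ≡⟨ cong (λ c → fromℤ (+ d) ℚ.* (fromℤ (+ c) ℚ.* defect N)) ([n+1]Cn≡n+1 N) ⟩
          fromℤ (+ d) ℚ.* (fromℤ (+ suc N) ℚ.* defect N)
            ≡⟨ ℚP.*-assoc (fromℤ (+ d)) (fromℤ (+ suc N)) (defect N) ⟨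
          fromℤ (+ d) ℚ.* fromℤ (+ suc N) ℚ.* defect N
            ≡⟨ cong (ℚ._* defect N) (ℚP.*-comm (fromℤ (+ d)) (fromℤ (+ suc N))) ⟩
          fromℤ (+ suc N) ℚ.* fromℤ (+ d) ℚ.* defect N
            ≡⟨ cong (ℚ._* defect N) (fromℤ-+-* (suc N) d) ⟨
          fromℤ (+ (suc N !)) ℚ.* defect N ∎

^-distribʳ-* : ∀ (a b : ℤ) n → (a ℤ.* b) ℤ.^ n ≡ a ℤ.^ n ℤ.* b ℤ.^ n
^-distribʳ-* a b zero    = refl
^-distribʳ-* a b (suc n) = ≡.trans (cong ((a ℤ.* b) ℤ.*_) (^-distribʳ-* a b n)) (interchange a b (a ℤ.^ n) (b ℤ.^ n))
  where
  interchange : ∀ a b c d → (a ℤ.* b) ℤ.* (c ℤ.* d) ≡ (a ℤ.* c) ℤ.* (b ℤ.* d)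
  interchange = solve-∀

pos-^ : ∀ a n → (+ a) ℤ.^ n ≡ + (a ℕ.^ n)
pos-^ a zero    = refl
pos-^ a (suc n) = ≡.trans (cong ((+ a) ℤ.*_) (pos-^ a n)) (≡.sym (ℤP.pos-* a (a ℕ.^ n)))

monomial-^ : ∀ c (x y : ℤ) k e m →
  (+ c ℤ.* x ℤ.^ k ℤ.* y ℤ.^ e) ℤ.^ m ≡ + (c ℕ.^ m) ℤ.* (x ℤ.^ (k ℕ.* m) ℤ.* y ℤ.^ (e ℕ.* m))
monomial-^ c x y k e m = begin
  (+ c ℤ.* x ℤ.^ k ℤ.* y ℤ.^ e) ℤ.^ m
    ≡⟨ ^-distribʳ-* _ _ m ⟩
  (+ c ℤ.* x ℤ.^ k) ℤ.^ m ℤ.* (y ℤ.^ e) ℤ.^ m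
    ≡⟨ cong (ℤ._* (y ℤ.^ e) ℤ.^ m) (^-distribʳ-* _ _ m) ⟩
  (+ c) ℤ.^ m ℤ.* (x ℤ.^ k) ℤ.^ m ℤ.* (y ℤ.^ e) ℤ.^ m
    ≡⟨ cong₂ (λ a b → a ℤ.* b ℤ.* (y ℤ.^ e) ℤ.^ m) (pos-^ c m) (ℤP.^-*-assoc x k m) ⟩
  + (c ℕ.^ m) ℤ.* x ℤ.^ (k ℕ.* m) ℤ.* (y ℤ.^ e) ℤ.^ m
    ≡⟨ cong (λ b → + (c ℕ.^ m) ℤ.* x ℤ.^ (k ℕ.* m) ℤ.* b) (ℤP.^-*-assoc y e m) ⟩
  + (c ℕ.^ m) ℤ.* x ℤ.^ (k ℕ.* m) ℤ.* y ℤ.^ (e ℕ.* m)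
    ≡⟨ ℤP.*-assoc (+ (c ℕ.^ m)) (x ℤ.^ (k ℕ.* m)) (y ℤ.^ (e ℕ.* m)) ⟩
  + (c ℕ.^ m) ℤ.* (x ℤ.^ (k ℕ.* m) ℤ.* y ℤ.^ (e ℕ.* m)) ∎
  where open ≡-Reasoning

ΣF-∸-distrib : ∀ k {s} (n m : Fin s → ℕ) → (∀ i → k ≤ n i) →
  ΣF (λ i → n i ℕ.* m i) ∸ ΣF m ℕ.* k ≡ ΣF (λ i → (n i ∸ k) ℕ.* m i)
ΣF-∸-distrib k n m k≤n = ≡.trans (cong (_∸ ΣF m ℕ.* k) (split n m k≤n)) (ℕP.m+n∸n≡m _ (ΣF m ℕ.* k))
  where
  split : ∀ {s} (n m : Fin s → ℕ) → (∀ i → k ≤ n i) →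
    ΣF (λ i → n i ℕ.* m i) ≡ ΣF (λ i → (n i ∸ k) ℕ.* m i) ℕ.+ ΣF m ℕ.* k
  split {zero}  n m _   = refl
  split {suc s} n m k≤n = begin
    n zero ℕ.* m zero ℕ.+ ΣF (λ i → n (suc i) ℕ.* m (suc i))
      ≡⟨ cong₂ ℕ._+_ (cong (ℕ._* m zero) (≡.sym (ℕP.m∸n+n≡m (k≤n zero))))
                     (split (λ i → n (suc i)) (λ i → m (suc i)) (λ i → k≤n (suc i))) ⟩
    (n zero ∸ k ℕ.+ k) ℕ.* m zero ℕ.+ (E ℕ.+ M ℕ.* k)
      ≡⟨ regroup (n zero ∸ k) k (m zero) E M ⟩
    ((n zero ∸ k) ℕ.* m zero ℕ.+ E) ℕ.+ (m zero ℕ.+ M) ℕ.* k ∎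
    where
    open ≡-Reasoning
    E = ΣF (λ i → (n (suc i) ∸ k) ℕ.* m (suc i))
    M = ΣF (λ i → m (suc i))
    regroup : ∀ a k b e M → (a ℕ.+ k) ℕ.* b ℕ.+ (e ℕ.+ M ℕ.* k) ≡ (a ℕ.* b ℕ.+ e) ℕ.+ (b ℕ.+ M) ℕ.* k
    regroup = ℕSolver.solve-∀

bernProd-factor : ∀ k {s} (n m : Fin s → ℕ) x →
  bernProd k n m x ≡
  + ΠFℕ (λ i → (n i C k) ℕ.^ m i) ℤ.* (x ℤ.^ (ΣF m ℕ.* k) ℤ.* (+ 1 ℤ.- x) ℤ.^ ΣF (λ i → (n i ∸ k) ℕ.* m i))
bernProd-factor k {zero}  n m x = refl
bernProd-factor k {suc s} n m x = begin
  bernstein k (n zero) x ℤ.^ m zero ℤ.* bernProd k (λ i → n (suc i)) (λ i → m (suc i)) x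
    ≡⟨ cong₂ ℤ._*_ (monomial-^ (n zero C k) x y k (n zero ∸ k) (m zero))
                   (bernProd-factor k (λ i → n (suc i)) (λ i → m (suc i)) x) ⟩
  + c ℤ.* (x ℤ.^ (k ℕ.* m zero) ℤ.* y ℤ.^ e) ℤ.* (+ A ℤ.* (x ℤ.^ a ℤ.* y ℤ.^ e′))
    ≡⟨ interchange (+ c) (+ A) (x ℤ.^ (k ℕ.* m zero)) (x ℤ.^ a) (y ℤ.^ e) (y ℤ.^ e′) ⟩
  (+ c ℤ.* + A) ℤ.* ((x ℤ.^ (k ℕ.* m zero) ℤ.* x ℤ.^ a) ℤ.* (y ℤ.^ e ℤ.* y ℤ.^ e′))
    ≡⟨ cong₂ ℤ._*_ (ℤP.pos-* c A) (cong₂ ℤ._*_ (ℤP.^-distribˡ-+-* x (k ℕ.* m zero) a) (ℤP.^-distribˡ-+-* y e e′)) ⟨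
  + (c ℕ.* A) ℤ.* (x ℤ.^ (k ℕ.* m zero ℕ.+ a) ℤ.* y ℤ.^ (e ℕ.+ e′))
    ≡⟨ cong (λ d → + (c ℕ.* A) ℤ.* (x ℤ.^ d ℤ.* y ℤ.^ (e ℕ.+ e′))) (exponent k (m zero) M) ⟩
  + (c ℕ.* A) ℤ.* (x ℤ.^ ((m zero ℕ.+ M) ℕ.* k) ℤ.* y ℤ.^ (e ℕ.+ e′)) ∎
  where
  open ≡-Reasoning
  y = + 1 ℤ.- x
  c = (n zero C k) ℕ.^ m zero
  A = ΠFℕ (λ i → (n (suc i) C k) ℕ.^ m (suc i))
  M = ΣF (λ i → m (suc i))
  a = M ℕ.* k
  e = (n zero ∸ k) ℕ.* m zero
  e′ = ΣF (λ i → (n (suc i) ∸ k) ℕ.* m (suc i))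
  interchange : ∀ c A u u′ v v′ → c ℤ.* (u ℤ.* v) ℤ.* (A ℤ.* (u′ ℤ.* v′)) ≡ (c ℤ.* A) ℤ.* ((u ℤ.* u′) ℤ.* (v ℤ.* v′))
  interchange = solve-∀
  exponent : ∀ k m M → k ℕ.* m ℕ.+ M ℕ.* k ≡ (m ℕ.+ M) ℕ.* k
  exponent = ℕSolver.solve-∀

signedBinomial : ℕ → ℕ → ℤ
signedBinomial D l = (-[1+ 0 ] ℤ.^ l) ℤ.* + (D C l)

neg-^ : ∀ x l → (ℤ.- x) ℤ.^ l ≡ (-[1+ 0 ] ℤ.^ l) ℤ.* x ℤ.^ l
neg-^ x zero    = refl
neg-^ x (suc l) = ≡.trans (cong ((ℤ.- x) ℤ.*_) (neg-^ x l)) (interchange x (-[1+ 0 ] ℤ.^ l) (x ℤ.^ l))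
  where
  interchange : ∀ x a b → ℤ.- x ℤ.* (a ℤ.* b) ≡ (ℤ.- (+ 1) ℤ.* a) ℤ.* (x ℤ.* b)
  interchange = solve-∀

binomial-1- : ∀ D x → (+ 1 ℤ.- x) ℤ.^ D ≡ Σ< (suc D) (λ l → signedBinomial D l ℤ.* x ℤ.^ l)
binomial-1- D x = ≡.trans (binomial D (ℤ.- x)) (ℤ∑.∑-cong (suc D) λ l →
  ≡.trans (cong (+ (D C l) ℤ.*_) (neg-^ x l)) (rotate (+ (D C l)) (-[1+ 0 ] ℤ.^ l) (x ℤ.^ l)))
  where
  rotate : ∀ c a b → c ℤ.* (a ℤ.* b) ≡ (a ℤ.* c) ℤ.* b
  rotate = solve-∀

Σ<-x^a[1-x]^D : ∀ a D L → Σ< L (λ x → (+ x) ℤ.^ a ℤ.* (+ 1 ℤ.- + x) ℤ.^ D) ≡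
                           Σ< (suc D) (λ l → signedBinomial D l ℤ.* powerSum (a ℕ.+ l) L)
Σ<-x^a[1-x]^D a D L = begin
  Σ< L (λ x → (+ x) ℤ.^ a ℤ.* (+ 1 ℤ.- + x) ℤ.^ D)
    ≡⟨ ℤ∑.∑-cong L (λ x → cong ((+ x) ℤ.^ a ℤ.*_) (binomial-1- D (+ x))) ⟩
  Σ< L (λ x → (+ x) ℤ.^ a ℤ.* Σ< (suc D) (λ l → signedBinomial D l ℤ.* (+ x) ℤ.^ l))
    ≡⟨ ℤ∑.∑-cong L (λ x → ℤ∑.*-distribˡ-∑ (suc D) ((+ x) ℤ.^ a) _) ⟩
  Σ< L (λ x → Σ< (suc D) (λ l → (+ x) ℤ.^ a ℤ.* (signedBinomial D l ℤ.* (+ x) ℤ.^ l)))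
    ≡⟨ ℤ∑.∑-cong L (λ x → ℤ∑.∑-cong (suc D) (λ l → merge (+ x) l)) ⟩
  Σ< L (λ x → Σ< (suc D) (λ l → signedBinomial D l ℤ.* (+ x) ℤ.^ (a ℕ.+ l)))
    ≡⟨ ℤ∑.∑-comm L (suc D) _ ⟩
  Σ< (suc D) (λ l → Σ< L (λ x → signedBinomial D l ℤ.* (+ x) ℤ.^ (a ℕ.+ l)))
    ≡⟨ ℤ∑.∑-cong (suc D) (λ l → ℤ∑.*-distribˡ-∑ L (signedBinomial D l) _) ⟨
  Σ< (suc D) (λ l → signedBinomial D l ℤ.* powerSum (a ℕ.+ l) L) ∎
  where
  open ≡-Reasoning
  commute : ∀ u c v → u ℤ.* (c ℤ.* v) ≡ c ℤ.* (u ℤ.* v)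
  commute = solve-∀
  merge : ∀ x l → x ℤ.^ a ℤ.* (signedBinomial D l ℤ.* x ℤ.^ l) ≡ signedBinomial D l ℤ.* x ℤ.^ (a ℕ.+ l)
  merge x l = ≡.trans (commute (x ℤ.^ a) (signedBinomial D l) (x ℤ.^ l))
    (cong (signedBinomial D l ℤ.*_) (≡.sym (ℤP.^-distribˡ-+-* x a l)))

factorial-combination-∈ℤ· : ∀ L a D →
  fromℤ (+ (suc (a ℕ.+ D) !)) ℚ.*
    (fromℤ (Σ< (suc D) (λ l → signedBinomial D l ℤ.* powerSum (a ℕ.+ l) L)) ℚ.-
     fromℤ (+ L) ℚ.* Σ<ℚ (suc D) (λ l → fromℤ (signedBinomial D l) ℚ.* bernoulli (a ℕ.+ l)))
  ∈ℤ· (+ L ℤ.* + L)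
factorial-combination-∈ℤ· L a D =
  ≡.subst (λ t → fromℤ (+ (suc (a ℕ.+ D) !)) ℚ.* t ∈ℤ· (+ L ℤ.* + L))
          (Σ<ℚ-*-defect L (suc D) (signedBinomial D) (a ℕ.+_))
          (*-Σ<ℚ-∈ℤ· (suc D) (signedBinomial D) (λ l → defect L (a ℕ.+ l)) (λ l → suc (a ℕ.+ l) !) _
             (λ l _ → factorial-defect-∈ℤ· L (a ℕ.+ l))
             (λ { l (s≤s l≤D) → m≤n⇒m!∣n! (s≤s (ℕP.+-monoʳ-≤ a l≤D)) }))

^-monoʳ-∣ : ∀ p {i j} → i ≤ j → p ℕ.^ i ∣ p ℕ.^ j
^-monoʳ-∣ p {i} {j} i≤j = ≡.subst (p ℕ.^ i ∣_) p^i*p^[j∸i]≡p^j (m∣m*n (p ℕ.^ (j ∸ i)))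
  where
  p^i*p^[j∸i]≡p^j : p ℕ.^ i ℕ.* p ℕ.^ (j ∸ i) ≡ p ℕ.^ j
  p^i*p^[j∸i]≡p^j = ≡.trans (≡.sym (ℕP.^-distribˡ-+-* p i (j ∸ i))) (cong (p ℕ.^_) (ℕP.m+[n∸m]≡n i≤j))

module _ {p : ℕ} (prime : Prime p) where

  private instance
    p≢0 : NonZero p
    p≢0 = prime⇒nonZero prime

  n<p^n : ∀ n → n < p ℕ.^ n
  n<p^n zero    = s≤s z≤n
  n<p^n (suc n) = ℕP.<-≤-trans (s≤s (n<p^n n))
    (ℕP.^-monoʳ-< p (ℕ.nonTrivial⇒n>1 p {{prime⇒nonTrivial prime}}) (ℕP.n<1+n n))

  ¬p∣x∧p^k∣x*y⇒p^k∣y : ∀ {x} → ¬ p ∣ x → ∀ k y → p ℕ.^ k ∣ x ℕ.* y → p ℕ.^ k ∣ y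
  ¬p∣x∧p^k∣x*y⇒p^k∣y p∤x zero    y _ = 1∣ y
  ¬p∣x∧p^k∣x*y⇒p^k∣y {x} p∤x (suc k) y p^[1+k]∣xy with euclidsLemma x y prime (∣-trans (m∣m*n (p ℕ.^ k)) p^[1+k]∣xy)
  ... | inj₁ p∣x = contradiction p∣x p∤x
  ... | inj₂ (divides y′ refl) = ≡.subst (p ℕ.^ suc k ∣_) (ℕP.*-comm p y′) (*-monoʳ-∣ p p^k∣y′)
    where
    x[y′p]≡p[xy′] : ∀ x y p → x ℕ.* (y ℕ.* p) ≡ p ℕ.* (x ℕ.* y)
    x[y′p]≡p[xy′] = ℕSolver.solve-∀
    p^k∣y′ : p ℕ.^ k ∣ y′
    p^k∣y′ = ¬p∣x∧p^k∣x*y⇒p^k∣y p∤x k y′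
      (*-cancelˡ-∣ p (≡.subst (p ℕ.* p ℕ.^ k ∣_) (x[y′p]≡p[xy′] x y′ p) p^[1+k]∣xy))

  p^[e+g]∣x*g⇒p^e∣x : ∀ e g x → 1 ≤ g → p ℕ.^ (e ℕ.+ g) ∣ x ℕ.* g → p ℕ.^ e ∣ x
  p^[e+g]∣x*g⇒p^e∣x zero    g x _   _ = 1∣ x
  p^[e+g]∣x*g⇒p^e∣x (suc e) g x 1≤g p^[1+e+g]∣xg with p ∣? x
  ... | yes (divides x′ refl) = ≡.subst (p ℕ.^ suc e ∣_) (ℕP.*-comm p x′) (*-monoʳ-∣ p p^e∣x′)
    where
    x′pg≡p[x′g] : x′ ℕ.* p ℕ.* g ≡ p ℕ.* (x′ ℕ.* g)
    x′pg≡p[x′g] = ≡.trans (cong (ℕ._* g) (ℕP.*-comm x′ p)) (ℕP.*-assoc p x′ g)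
    p^e∣x′ : p ℕ.^ e ∣ x′
    p^e∣x′ = p^[e+g]∣x*g⇒p^e∣x e g x′ 1≤g
      (*-cancelˡ-∣ p (≡.subst (p ℕ.* p ℕ.^ (e ℕ.+ g) ∣_) x′pg≡p[x′g] p^[1+e+g]∣xg))
  ... | no p∤x = contradiction (∣⇒≤ p^[1+e+g]∣g)
                   (ℕP.<⇒≱ (ℕP.<-≤-trans (n<p^n g) (ℕP.^-monoʳ-≤ p (ℕP.m≤n+m g (suc e)))))
    where
    instance
      g≢0 : NonZero g
      g≢0 = ℕ.>-nonZero 1≤g
    p^[1+e+g]∣g : p ℕ.^ (suc e ℕ.+ g) ∣ g
    p^[1+e+g]∣g = ¬p∣x∧p^k∣x*y⇒p^k∣y p∤x (suc e ℕ.+ g) g p^[1+e+g]∣xg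

L*[d*q]∈ℤL²⇒L∣↥q*d : ∀ L .{{_ : NonZero L}} q d →
  fromℤ (+ L) ℚ.* (fromℤ (+ d) ℚ.* q) ∈ℤ· (+ L ℤ.* + L) → L ∣ ℤ.∣ ↥ q ∣ ℕ.* d
L*[d*q]∈ℤL²⇒L∣↥q*d L q d (z , eq) = divides ℤ.∣ z ℤ.* ↧ q ∣ (begin
  ℤ.∣ ↥ q ∣ ℕ.* d                ≡⟨ ℤP.abs-* (↥ q) (+ d) ⟨
  ℤ.∣ ↥ q ℤ.* + d ∣              ≡⟨ cong ℤ.∣_∣ ↥q*d≡z↧q*L ⟩
  ℤ.∣ (z ℤ.* ↧ q) ℤ.* + L ∣      ≡⟨ ℤP.abs-* (z ℤ.* ↧ q) (+ L) ⟩
  ℤ.∣ z ℤ.* ↧ q ∣ ℕ.* L          ∎)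
  where
  open ≡-Reasoning
  q*dL≡zLL : q ℚ.* fromℤ (+ d ℤ.* + L) ≡ fromℤ (z ℤ.* (+ L ℤ.* + L))
  q*dL≡zLL = ≡.trans (cong (q ℚ.*_) (fromℤ-homo-* (+ d) (+ L)))
               (≡.trans (rotate q (fromℤ (+ d)) (fromℤ (+ L))) eq)
    where
    rotate : ∀ q d l → q ℚ.* (d ℚ.* l) ≡ l ℚ.* (d ℚ.* q)
    rotate = solve 3 (λ q d l → q :* (d :* l) := l :* (d :* q)) refl
  ↥q*d≡z↧q*L : ↥ q ℤ.* + d ≡ (z ℤ.* ↧ q) ℤ.* + L
  ↥q*d≡z↧q*L = ℤP.*-cancelʳ-≡ _ _ (+ L) (begin
    ↥ q ℤ.* + d ℤ.* + L                ≡⟨ ℤP.*-assoc (↥ q) (+ d) (+ L) ⟩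
    ↥ q ℤ.* (+ d ℤ.* + L)              ≡⟨ q*b≡c⇒↥q*b≡c*↧q q (+ d ℤ.* + L) (z ℤ.* (+ L ℤ.* + L)) q*dL≡zLL ⟩
    z ℤ.* (+ L ℤ.* + L) ℤ.* ↧ q        ≡⟨ regroup z (+ L) (↧ q) ⟩
    z ℤ.* ↧ q ℤ.* + L ℤ.* + L          ∎)
    where
    regroup : ∀ z l r → z ℤ.* (l ℤ.* l) ℤ.* r ≡ z ℤ.* r ℤ.* l ℤ.* l
    regroup = solve-∀

module _ (k : ℕ) {s : ℕ} (n m : Fin s → ℕ) (k≤n : ∀ i → k ≤ n i) where

  private
    A = ΠFℕ (λ i → (n i C k) ℕ.^ m i)
    a = ΣF m ℕ.* k
    D = ΣF (λ i → n i ℕ.* m i) ∸ a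

  Σ<-bernProd : ∀ L → Σ< L (λ x → bernProd k n m (+ x)) ≡
                      + A ℤ.* Σ< (suc D) (λ l → signedBinomial D l ℤ.* powerSum (a ℕ.+ l) L)
  Σ<-bernProd L = begin
    Σ< L (λ x → bernProd k n m (+ x))
      ≡⟨ ℤ∑.∑-cong L (λ x → bernProd-factor k n m (+ x)) ⟩
    Σ< L (λ x → + A ℤ.* ((+ x) ℤ.^ a ℤ.* (+ 1 ℤ.- + x) ℤ.^ ΣF (λ i → (n i ∸ k) ℕ.* m i)))
      ≡⟨ cong (λ e → Σ< L (λ x → + A ℤ.* ((+ x) ℤ.^ a ℤ.* (+ 1 ℤ.- + x) ℤ.^ e))) (ΣF-∸-distrib k n m k≤n) ⟨
    Σ< L (λ x → + A ℤ.* ((+ x) ℤ.^ a ℤ.* (+ 1 ℤ.- + x) ℤ.^ D))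
      ≡⟨ ℤ∑.*-distribˡ-∑ L (+ A) _ ⟨
    + A ℤ.* Σ< L (λ x → (+ x) ℤ.^ a ℤ.* (+ 1 ℤ.- + x) ℤ.^ D)
      ≡⟨ cong (+ A ℤ.*_) (Σ<-x^a[1-x]^D a D L) ⟩
    + A ℤ.* Σ< (suc D) (λ l → signedBinomial D l ℤ.* powerSum (a ℕ.+ l) L) ∎
    where open ≡-Reasoning

  riemannError-∣ : ∀ L .{{_ : NonZero L}} →
    L ∣ ℤ.∣ ↥ ((Σ< L (λ x → bernProd k n m (+ x)) ℚ./ L) ℚ.- rhs k n m) ∣ ℕ.* (suc (a ℕ.+ D) !)
  riemannError-∣ L = L*[d*q]∈ℤL²⇒L∣↥q*d L (R ℚ.- rhs k n m) (suc (a ℕ.+ D) !)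
    (≡.subst (_∈ℤ· (+ L ℤ.* + L)) (≡.sym scaledError≡) (*-∈ℤ· (+ A) (factorial-combination-∈ℤ· L a D)))
    where
    open ≡-Reasoning
    l = fromℤ (+ L)
    d = fromℤ (+ (suc (a ℕ.+ D) !))
    R = Σ< L (λ x → bernProd k n m (+ x)) ℚ./ L
    W = Σ< (suc D) (λ l → signedBinomial D l ℤ.* powerSum (a ℕ.+ l) L)
    SB = Σ<ℚ (suc D) (λ l → fromℤ (signedBinomial D l) ℚ.* bernoulli (a ℕ.+ l))
    l*R≡A*W : l ℚ.* R ≡ fromℤ (+ A) ℚ.* fromℤ W
    l*R≡A*W = ≡.trans (fromℤ-*-/ (Σ< L (λ x → bernProd k n m (+ x))) L) (≡.trans (cong fromℤ (Σ<-bernProd L)) (fromℤ-homo-* (+ A) W))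
    scaledError≡ : l ℚ.* (d ℚ.* (R ℚ.- rhs k n m)) ≡ fromℤ (+ A) ℚ.* (d ℚ.* (fromℤ W ℚ.- l ℚ.* SB))
    scaledError≡ = begin
      l ℚ.* (d ℚ.* (R ℚ.- fromℤ (+ A) ℚ.* SB))
        ≡⟨ expand l d R (fromℤ (+ A)) SB (fromℤ W) ⟩
      fromℤ (+ A) ℚ.* (d ℚ.* (fromℤ W ℚ.- l ℚ.* SB)) ℚ.+ d ℚ.* (l ℚ.* R ℚ.- fromℤ (+ A) ℚ.* fromℤ W)
        ≡⟨ cong (λ t → fromℤ (+ A) ℚ.* (d ℚ.* (fromℤ W ℚ.- l ℚ.* SB)) ℚ.+ d ℚ.* (t ℚ.- fromℤ (+ A) ℚ.* fromℤ W)) l*R≡A*W ⟩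
      fromℤ (+ A) ℚ.* (d ℚ.* (fromℤ W ℚ.- l ℚ.* SB)) ℚ.+ d ℚ.* (fromℤ (+ A) ℚ.* fromℤ W ℚ.- fromℤ (+ A) ℚ.* fromℤ W)
        ≡⟨ cancel (fromℤ (+ A) ℚ.* (d ℚ.* (fromℤ W ℚ.- l ℚ.* SB))) d (fromℤ (+ A) ℚ.* fromℤ W) ⟩
      fromℤ (+ A) ℚ.* (d ℚ.* (fromℤ W ℚ.- l ℚ.* SB)) ∎
      where
      expand : ∀ l d R A SB W → l ℚ.* (d ℚ.* (R ℚ.- A ℚ.* SB)) ≡ A ℚ.* (d ℚ.* (W ℚ.- l ℚ.* SB)) ℚ.+ d ℚ.* (l ℚ.* R ℚ.- A ℚ.* W)
      expand = solve 6 (λ l d R A SB W → l :* (d :* (R :- A :* SB)) := A :* (d :* (W :- l :* SB)) :+ d :* (l :* R :- A :* W)) refl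
      cancel : ∀ x d y → x ℚ.+ d ℚ.* (y ℚ.- y) ≡ x
      cancel = solve 3 (λ x d y → x :+ d :* (y :- y) := x) refl

mainTheorem5 : (p : ℕ) (pr : Prime p) (s : ℕ) (m n : Fin s → ℕ) (k : ℕ) →
    (∀ i → 1 ≤ m i) → (∀ i → k ≤ n i) →
    VolkenbornIntegral≡ p pr (bernProd k n m) (rhs k n m)
mainTheorem5 p pr s m n k _ k≤n e = e ℕ.+ d , λ N e+d≤N →
  p^[e+g]∣x*g⇒p^e∣x pr e d _ (ℕP.1≤n! (suc (a ℕ.+ D)))
    (∣-trans (^-monoʳ-∣ p e+d≤N) (riemannError-∣ k n m k≤n (p ℕ.^ N) {{ℕP.m^n≢0 p N}}))
  where
  instance
    p≢0 : NonZero p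
    p≢0 = prime⇒nonZero pr
  a = ΣF m ℕ.* k
  D = ΣF (λ i → n i ℕ.* m i) ∸ a
  d = suc (a ℕ.+ D) !
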